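{- Let $(J_n)_{n\ge 0}$ be the Jacobsthal numbers and, for $n\ge 0$, let $$HSJ_n=\begin{bmatrix} J_n+jJ_{n+3}\\ -J_{n+1}+jJ_{n+2}\end{bmatrix}.$$ Then for all $n\ge 1$: (1) $\displaystyle\sum_{i=1}^{n} HSJ_{2i}=\frac23 HSJ_{2n+1}+\frac13\left(HSJ_2-(2n+1)HSJ_3+n\,HSJ_4\right)$; (2) $\displaystyle\sum_{i=1}^{n} HSJ_{2i-1}=\frac23 HSJ_{2n}-\frac13\left(n\,HSJ_4-2n\,HSJ_3+2\,HSJ_0\right)$.
   Context: The Jacobsthal numbers are defined by $J_0=0$, $J_1=1$, $J_{n+2}=J_{n+1}+2J_n$. Here $j$ is the hyperbolic unit ($j^2=1$, $j\neq\pm1$); spinors are column vectors with two hyperbolic-number entries, added and multiplied by real scalars componentwise. -}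

module Defs where

open import Data.Nat using (ℕ; zero; suc)
open import Data.Integer using (ℤ; +_)
open import Data.Rational using (ℚ; _/_; _+_; _*_; -_; 0ℚ)

J : ℕ → ℕ
J zero = 0
J (suc zero) = 1
J (suc (suc n)) = J (suc n) Data.Nat.+ 2 Data.Nat.* J n

⟦_⟧ : ℕ → ℚ
⟦ n ⟧ = (+ n) / 1

-- hyperbolic numbers a + j b (j² = 1), with rational components
record Hyp : Set where
  constructor hyp
  field
    re : ℚ
    hy : ℚ

record Spinor : Set where
  constructor spinor
  field
    top : Hyp
    bot : Hyp

open Hyp
open Spinor

_+ʰ_ : Hyp → Hyp → Hyp
x +ʰ y = hyp (re x + re y) (hy x + hy y)

_·ʰ_ : ℚ → Hyp → Hyp
c ·ʰ x = hyp (c * re x) (c * hy x)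

_+ˢ_ : Spinor → Spinor → Spinor
u +ˢ v = spinor (top u +ʰ top v) (bot u +ʰ bot v)

_·ˢ_ : ℚ → Spinor → Spinor
c ·ˢ u = spinor (c ·ʰ top u) (c ·ʰ bot u)

_-ˢ_ : Spinor → Spinor → Spinor
u -ˢ v = u +ˢ ((- ((+ 1) / 1)) ·ˢ v)

infixl 6 _+ˢ_ _-ˢ_
infixl 7 _·ˢ_

zeroˢ : Spinor
zeroˢ = spinor (hyp 0ℚ 0ℚ) (hyp 0ℚ 0ℚ)

HSJ : ℕ → Spinor
HSJ n = spinor (hyp ⟦ J n ⟧ ⟦ J (suc (suc (suc n))) ⟧)
               (hyp (- ⟦ J (suc n) ⟧) ⟦ J (suc (suc n)) ⟧)

sumFrom1 : ℕ → (ℕ → Spinor) → Spinor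
sumFrom1 zero f = zeroˢ
sumFrom1 (suc n) f = sumFrom1 n f +ˢ f (suc n)

-- Every coordinate of HSJ, viewed as a rational sequence a, satisfies the
-- Jacobsthal recurrence a (k+2) = a (k+1) + 2 a k, and both identities hold for
-- any such sequence.  The key invariant is that the gap a (k+1) − 2 a k only
-- changes sign from one index to the next, so a (2n+1) = 2 a (2n) + (a 1 − 2 a 0)
-- for every n; with it, each induction step of the two sums is a polynomial
-- identity.
module Submission where

open import Defs
open import Data.Nat using (ℕ; zero; suc; _≤_; _*_; _∸_)
import Data.Nat as ℕ
open import Data.Nat.Properties using (*-suc)
import Data.Nat.Coprimality as Coprimality
import Data.Integer as ℤ
open import Data.Integer using (+_)
import Data.Integer.Properties as ℤ
open import Data.Rational using (ℚ; mkℚ; _/_; _+_; -_; 0ℚ) renaming (_*_ to _·_)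
open import Data.Rational.Properties using (normalize-coprime; /-cong)
open import Data.Rational.Solver using (module +-*-Solver)
open +-*-Solver using (solve; Polynomial; _:=_; con; _:+_; _:*_; :-_)
open import Data.Product using (_×_; _,_)
open import Relation.Binary.PropositionalEquality
  using (_≡_; refl; sym; trans; cong; cong₂; module ≡-Reasoning)

open Hyp
open Spinor

⟦⟧≡mkℚ : ∀ n → ⟦ n ⟧ ≡ mkℚ (+ n) 0 (Coprimality.sym (Coprimality.1-coprimeTo n))
⟦⟧≡mkℚ n = normalize-coprime (Coprimality.sym (Coprimality.1-coprimeTo n))

⟦⟧-+ : ∀ m n → ⟦ m ℕ.+ n ⟧ ≡ ⟦ m ⟧ + ⟦ n ⟧
⟦⟧-+ m n = sym (trans (cong₂ _+_ (⟦⟧≡mkℚ m) (⟦⟧≡mkℚ n))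
  (/-cong (trans (cong₂ ℤ._+_ (ℤ.*-identityʳ (+ m)) (ℤ.*-identityʳ (+ n))) (sym (ℤ.pos-+ m n))) refl))

⟦⟧-* : ∀ m n → ⟦ m * n ⟧ ≡ ⟦ m ⟧ · ⟦ n ⟧
⟦⟧-* m n = sym (trans (cong₂ _·_ (⟦⟧≡mkℚ m) (⟦⟧≡mkℚ n)) (/-cong (sym (ℤ.pos-* m n)) refl))

-- _⊖_ and the closed forms unfold the spinor operations of Defs coordinatewise,
-- so that each coordinate of a right-hand side of the theorem is definitionally
-- the corresponding closed form.
infixl 6 _⊖_
_⊖_ : ℚ → ℚ → ℚ
p ⊖ q = p + (- ((+ 1) / 1)) · q

sumFrom1ℚ : ℕ → (ℕ → ℚ) → ℚ
sumFrom1ℚ zero    f = 0ℚ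
sumFrom1ℚ (suc n) f = sumFrom1ℚ n f + f (suc n)

record JacobsthalLike (a : ℕ → ℚ) : Set where
  constructor jacobsthalLike
  field
    recurrence : ∀ k → a (suc (suc k)) ≡ a (suc k) + ⟦ 2 ⟧ · a k

evenSumClosedForm : (ℕ → ℚ) → ℕ → ℚ
evenSumClosedForm a n =
  (+ 2) / 3 · a (suc (2 * n)) + (+ 1) / 3 · (a 2 ⊖ ⟦ suc (2 * n) ⟧ · a 3 + ⟦ n ⟧ · a 4)

oddSumClosedForm : (ℕ → ℚ) → ℕ → ℚ
oddSumClosedForm a n =
  (+ 2) / 3 · a (2 * n) ⊖ (+ 1) / 3 · (⟦ n ⟧ · a 4 ⊖ ⟦ 2 * n ⟧ · a 3 + ⟦ 2 ⟧ · a 0)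

-- Each hypothesis below names a variable on its left, so matching it with refl
-- substitutes its definition and leaves an identity in the remaining variables
-- for the ring solver.
module Identities where
  infixl 7 _:⊖_
  _:⊖_ : ∀ {m} → Polynomial m → Polynomial m → Polynomial m
  p :⊖ q = p :+ con (- ((+ 1) / 1)) :* q

  gap-period-two : ∀ p g {u v w} →
    u ≡ ⟦ 2 ⟧ · p + g → v ≡ u + ⟦ 2 ⟧ · p → w ≡ v + ⟦ 2 ⟧ · u →
    w ≡ ⟦ 2 ⟧ · v + g
  gap-period-two p g refl refl refl =
    solve 2 (λ p g → let 𝟚 = con ⟦ 2 ⟧ ; u = 𝟚 :* p :+ g ; v = u :+ 𝟚 :* p in
                     v :+ 𝟚 :* u := 𝟚 :* v :+ g) refl p g

  x≡y+[x⊖y] : ∀ x y → x ≡ y + (x ⊖ y)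
  x≡y+[x⊖y] = solve 2 (λ x y → x := y :+ (x :⊖ y)) refl

  neg-recurrence : ∀ x y → - (x + ⟦ 2 ⟧ · y) ≡ - x + ⟦ 2 ⟧ · (- y)
  neg-recurrence = solve 2 (λ x y → let 𝟚 = con ⟦ 2 ⟧ in
                            :- (x :+ 𝟚 :* y) := :- x :+ 𝟚 :* (:- y)) refl

  evens-base : ∀ a₁ a₂ a₄ {a₃} → a₃ ≡ a₂ + ⟦ 2 ⟧ · a₁ →
    0ℚ ≡ (+ 2) / 3 · a₁ + (+ 1) / 3 · (a₂ ⊖ ⟦ 1 ⟧ · a₃ + ⟦ 0 ⟧ · a₄)
  evens-base a₁ a₂ a₄ refl =
    solve 3 (λ a₁ a₂ a₄ → let a₃ = a₂ :+ con ⟦ 2 ⟧ :* a₁ in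
      con 0ℚ := con ((+ 2) / 3) :* a₁
                :+ con ((+ 1) / 3) :* (a₂ :⊖ con ⟦ 1 ⟧ :* a₃ :+ con ⟦ 0 ⟧ :* a₄)) refl a₁ a₂ a₄

  odds-base : ∀ a₀ a₃ a₄ →
    0ℚ ≡ (+ 2) / 3 · a₀ ⊖ (+ 1) / 3 · (⟦ 0 ⟧ · a₄ ⊖ ⟦ 0 ⟧ · a₃ + ⟦ 2 ⟧ · a₀)
  odds-base = solve 3 (λ a₀ a₃ a₄ →
    con 0ℚ := con ((+ 2) / 3) :* a₀
              :⊖ con ((+ 1) / 3) :* (con ⟦ 0 ⟧ :* a₄ :⊖ con ⟦ 0 ⟧ :* a₃ :+ con ⟦ 2 ⟧ :* a₀)) refl

  evens-step : ∀ a₀ a₁ p x y {a₂ a₃ a₄ u v w x′ y′} →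
    a₂ ≡ a₁ + ⟦ 2 ⟧ · a₀ → a₃ ≡ a₂ + ⟦ 2 ⟧ · a₁ → a₄ ≡ a₃ + ⟦ 2 ⟧ · a₂ →
    u ≡ ⟦ 2 ⟧ · p + (a₁ ⊖ ⟦ 2 ⟧ · a₀) → v ≡ u + ⟦ 2 ⟧ · p → w ≡ v + ⟦ 2 ⟧ · u →
    x′ ≡ ⟦ 1 ⟧ + x → y′ ≡ ⟦ 2 ⟧ + y →
    (+ 2) / 3 · u + (+ 1) / 3 · (a₂ ⊖ y · a₃ + x · a₄) + v
      ≡ (+ 2) / 3 · w + (+ 1) / 3 · (a₂ ⊖ y′ · a₃ + x′ · a₄)
  evens-step a₀ a₁ p x y refl refl refl refl refl refl refl refl =
    solve 5 (λ a₀ a₁ p x y →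
      let 𝟚 = con ⟦ 2 ⟧ ; a₂ = a₁ :+ 𝟚 :* a₀ ; a₃ = a₂ :+ 𝟚 :* a₁ ; a₄ = a₃ :+ 𝟚 :* a₂
          u = 𝟚 :* p :+ (a₁ :⊖ 𝟚 :* a₀) ; v = u :+ 𝟚 :* p ; w = v :+ 𝟚 :* u
          ⅔ = con ((+ 2) / 3) ; ⅓ = con ((+ 1) / 3) in
      ⅔ :* u :+ ⅓ :* (a₂ :⊖ y :* a₃ :+ x :* a₄) :+ v
        := ⅔ :* w :+ ⅓ :* (a₂ :⊖ (𝟚 :+ y) :* a₃ :+ (con ⟦ 1 ⟧ :+ x) :* a₄)) refl a₀ a₁ p x y

  odds-step : ∀ a₀ a₁ p x z {a₂ a₃ a₄ u t x′ z′} →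
    a₂ ≡ a₁ + ⟦ 2 ⟧ · a₀ → a₃ ≡ a₂ + ⟦ 2 ⟧ · a₁ → a₄ ≡ a₃ + ⟦ 2 ⟧ · a₂ →
    u ≡ ⟦ 2 ⟧ · p + (a₁ ⊖ ⟦ 2 ⟧ · a₀) → t ≡ u + ⟦ 2 ⟧ · p →
    x′ ≡ ⟦ 1 ⟧ + x → z′ ≡ ⟦ 2 ⟧ + z →
    (+ 2) / 3 · p ⊖ (+ 1) / 3 · (x · a₄ ⊖ z · a₃ + ⟦ 2 ⟧ · a₀) + u
      ≡ (+ 2) / 3 · t ⊖ (+ 1) / 3 · (x′ · a₄ ⊖ z′ · a₃ + ⟦ 2 ⟧ · a₀)
  odds-step a₀ a₁ p x z refl refl refl refl refl refl refl =
    solve 5 (λ a₀ a₁ p x z →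
      let 𝟚 = con ⟦ 2 ⟧ ; a₂ = a₁ :+ 𝟚 :* a₀ ; a₃ = a₂ :+ 𝟚 :* a₁ ; a₄ = a₃ :+ 𝟚 :* a₂
          u = 𝟚 :* p :+ (a₁ :⊖ 𝟚 :* a₀) ; t = u :+ 𝟚 :* p
          ⅔ = con ((+ 2) / 3) ; ⅓ = con ((+ 1) / 3) in
      ⅔ :* p :⊖ ⅓ :* (x :* a₄ :⊖ z :* a₃ :+ 𝟚 :* a₀) :+ u
        := ⅔ :* t :⊖ ⅓ :* ((con ⟦ 1 ⟧ :+ x) :* a₄ :⊖ (𝟚 :+ z) :* a₃ :+ 𝟚 :* a₀)) refl a₀ a₁ p x z

open Identities

module _ {a : ℕ → ℚ} (jl : JacobsthalLike a) where
  open ≡-Reasoning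
  open JacobsthalLike jl renaming (recurrence to rec)

  rec-even : ∀ n → a (2 * suc n) ≡ a (suc (2 * n)) + ⟦ 2 ⟧ · a (2 * n)
  rec-even n rewrite *-suc 2 n = rec (2 * n)

  rec-odd : ∀ n → a (suc (2 * suc n)) ≡ a (2 * suc n) + ⟦ 2 ⟧ · a (suc (2 * n))
  rec-odd n rewrite *-suc 2 n = rec (suc (2 * n))

  odd≡twice-even+gap : ∀ n → a (suc (2 * n)) ≡ ⟦ 2 ⟧ · a (2 * n) + (a 1 ⊖ ⟦ 2 ⟧ · a 0)
  odd≡twice-even+gap zero    = x≡y+[x⊖y] (a 1) (⟦ 2 ⟧ · a 0)
  odd≡twice-even+gap (suc n) =
    gap-period-two (a (2 * n)) (a 1 ⊖ ⟦ 2 ⟧ · a 0) (odd≡twice-even+gap n) (rec-even n) (rec-odd n)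

  sum-evens : ∀ n → sumFrom1ℚ n (λ i → a (2 * i)) ≡ evenSumClosedForm a n
  sum-evens zero    = evens-base (a 1) (a 2) (a 4) (rec 1)
  sum-evens (suc n) = begin
    sumFrom1ℚ n (λ i → a (2 * i)) + a (2 * suc n)
      ≡⟨ cong (_+ a (2 * suc n)) (sum-evens n) ⟩
    evenSumClosedForm a n + a (2 * suc n)
      ≡⟨ evens-step (a 0) (a 1) (a (2 * n)) ⟦ n ⟧ ⟦ suc (2 * n) ⟧
           (rec 0) (rec 1) (rec 2) (odd≡twice-even+gap n) (rec-even n) (rec-odd n)
           (⟦⟧-+ 1 n) ⟦1+2[1+n]⟧ ⟩
    evenSumClosedForm a (suc n) ∎
    where
    ⟦1+2[1+n]⟧ : ⟦ suc (2 * suc n) ⟧ ≡ ⟦ 2 ⟧ + ⟦ suc (2 * n) ⟧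
    ⟦1+2[1+n]⟧ = trans (cong (λ k → ⟦ suc k ⟧) (*-suc 2 n)) (⟦⟧-+ 2 (suc (2 * n)))

  sum-odds : ∀ n → sumFrom1ℚ n (λ i → a (2 * i ∸ 1)) ≡ oddSumClosedForm a n
  sum-odds zero    = odds-base (a 0) (a 3) (a 4)
  sum-odds (suc n) = begin
    sumFrom1ℚ n (λ i → a (2 * i ∸ 1)) + a (2 * suc n ∸ 1)
      ≡⟨ cong₂ _+_ (sum-odds n) (cong (λ k → a (k ∸ 1)) (*-suc 2 n)) ⟩
    oddSumClosedForm a n + a (suc (2 * n))
      ≡⟨ odds-step (a 0) (a 1) (a (2 * n)) ⟦ n ⟧ ⟦ 2 * n ⟧
           (rec 0) (rec 1) (rec 2) (odd≡twice-even+gap n) (rec-even n)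
           (⟦⟧-+ 1 n) ⟦2[1+n]⟧ ⟩
    oddSumClosedForm a (suc n) ∎
    where
    ⟦2[1+n]⟧ : ⟦ 2 * suc n ⟧ ≡ ⟦ 2 ⟧ + ⟦ 2 * n ⟧
    ⟦2[1+n]⟧ = trans (cong ⟦_⟧ (*-suc 2 n)) (⟦⟧-+ 2 (2 * n))

⟦J⟧-recurrence : ∀ k → ⟦ J (suc (suc k)) ⟧ ≡ ⟦ J (suc k) ⟧ + ⟦ 2 ⟧ · ⟦ J k ⟧
⟦J⟧-recurrence k =
  trans (⟦⟧-+ (J (suc k)) (2 * J k)) (cong (λ q → ⟦ J (suc k) ⟧ + q) (⟦⟧-* 2 (J k)))

jacobsthalLike-neg : ∀ {a} → JacobsthalLike a → JacobsthalLike (λ k → - a k)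
jacobsthalLike-neg {a} (jacobsthalLike rec) =
  jacobsthalLike λ k → trans (cong -_ (rec k)) (neg-recurrence (a (suc k)) (a k))

data Component : Set where
  top-re top-hy bot-re bot-hy : Component

component : Component → Spinor → ℚ
component top-re u = re (top u)
component top-hy u = hy (top u)
component bot-re u = re (bot u)
component bot-hy u = hy (bot u)

spinor-≡ : ∀ {u v} →
  component top-re u ≡ component top-re v → component top-hy u ≡ component top-hy v →
  component bot-re u ≡ component bot-re v → component bot-hy u ≡ component bot-hy v →
  u ≡ v
spinor-≡ e₁ e₂ e₃ e₄ = cong₂ spinor (cong₂ hyp e₁ e₂) (cong₂ hyp e₃ e₄)

component-+ˢ : ∀ c u v → component c (u +ˢ v) ≡ component c u + component c v
component-+ˢ top-re u v = refl
component-+ˢ top-hy u v = refl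
component-+ˢ bot-re u v = refl
component-+ˢ bot-hy u v = refl

component-zeroˢ : ∀ c → component c zeroˢ ≡ 0ℚ
component-zeroˢ top-re = refl
component-zeroˢ top-hy = refl
component-zeroˢ bot-re = refl
component-zeroˢ bot-hy = refl

component-sumFrom1 : ∀ c n f → component c (sumFrom1 n f) ≡ sumFrom1ℚ n (λ i → component c (f i))
component-sumFrom1 c zero    f = component-zeroˢ c
component-sumFrom1 c (suc n) f =
  trans (component-+ˢ c (sumFrom1 n f) (f (suc n)))
        (cong (_+ component c (f (suc n))) (component-sumFrom1 c n f))

HSJ-component-jacobsthalLike : ∀ c → JacobsthalLike (λ k → component c (HSJ k))
HSJ-component-jacobsthalLike top-re = jacobsthalLike ⟦J⟧-recurrence
HSJ-component-jacobsthalLike top-hy = jacobsthalLike λ k → ⟦J⟧-recurrence (3 ℕ.+ k)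
HSJ-component-jacobsthalLike bot-re = jacobsthalLike-neg (jacobsthalLike λ k → ⟦J⟧-recurrence (suc k))
HSJ-component-jacobsthalLike bot-hy = jacobsthalLike λ k → ⟦J⟧-recurrence (2 ℕ.+ k)

theorem3p7 : (n : ℕ) → 1 ≤ n →
    (sumFrom1 n (λ i → HSJ (2 * i))
      ≡ ((+ 2) / 3) ·ˢ HSJ (suc (2 * n))
        +ˢ ((+ 1) / 3) ·ˢ (HSJ 2 -ˢ ⟦ suc (2 * n) ⟧ ·ˢ HSJ 3 +ˢ ⟦ n ⟧ ·ˢ HSJ 4))
    × (sumFrom1 n (λ i → HSJ (2 * i Data.Nat.∸ 1))
      ≡ ((+ 2) / 3) ·ˢ HSJ (2 * n)
        -ˢ ((+ 1) / 3) ·ˢ (⟦ n ⟧ ·ˢ HSJ 4 -ˢ ⟦ 2 * n ⟧ ·ˢ HSJ 3 +ˢ ⟦ 2 ⟧ ·ˢ HSJ 0))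
theorem3p7 n _ =
    spinor-≡ (evens top-re) (evens top-hy) (evens bot-re) (evens bot-hy)
  , spinor-≡ (odds top-re) (odds top-hy) (odds bot-re) (odds bot-hy)
  where
  evens : ∀ c → component c (sumFrom1 n (λ i → HSJ (2 * i)))
                  ≡ evenSumClosedForm (λ k → component c (HSJ k)) n
  evens c = trans (component-sumFrom1 c n _) (sum-evens (HSJ-component-jacobsthalLike c) n)

  odds : ∀ c → component c (sumFrom1 n (λ i → HSJ (2 * i ∸ 1)))
                 ≡ oddSumClosedForm (λ k → component c (HSJ k)) n
  odds c = trans (component-sumFrom1 c n _) (sum-odds (HSJ-component-jacobsthalLike c) n)
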